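{- Let $G$ and $H$ be hypergraphs with $G\cong_f H$. Then: (1) $G$ and $H$ have the same number of vertices; (2) $G$ and $H$ have the same number of hyperedges; (3) $G$ and $H$ have the same degree sequence; (4) $G$ and $H$ have the same multiset of hyperedge sizes; (5) $G^*\cong_f H^*$.
   Context: A hypergraph $G=(V,X)$ consists of a finite vertex set $V$ and a family $X$ of subsets of $V$ (hyperedges). The degree of a vertex is the number of hyperedges containing it; the degree sequence is the multiset of vertex degrees. If $G$ has $n$ vertices and $m\ge1$ hyperedges, its vertex-hyperedge incidence matrix $M_G\in\{0,1\}^{n\times m}$ has $(i,j)$ entry $1$ iff vertex $i$ belongs to hyperedge $j$. The dual hypergraph $G^*$ is the hypergraph whose vertex-hyperedge incidence matrix is $M_G^t$. A doubly stochastic matrix is a square nonnegative matrix whose rows and columns each sum to $1$. For hypergraphs $G,H$, $G\cong_f H$ (fractional isomorphism) means: either $G$ and $H$ have the same number of vertices and no hyperedges, or there exist doubly stochastic matrices $S_1,S_2$ with $S_1M_G=M_HS_2^t$ and $M_GS_2=S_1^tM_H$.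
   Formalization: The doubly stochastic matrices in the definition of fractional isomorphism have entries in ℚ. -}

module Defs where

open import Data.Nat using (ℕ; zero; suc; _≤_)
open import Data.Fin using (Fin; zero; suc)
open import Data.Fin.Subset using (Subset; _∈_; ∣_∣)
open import Data.Fin.Subset.Properties using (_∈?_)
open import Data.Bool using (Bool; true; false)
open import Data.Vec using (tabulate; lookup)
open import Data.List using (List; map; allFin)
open import Data.Product using (Σ; _×_; _,_)
open import Data.Sum using (_⊎_)
open import Relation.Nullary using (Dec; yes; no)
open import Relation.Binary.PropositionalEquality using (_≡_)
open import Data.Rational using (ℚ; 0ℚ; 1ℚ; _+_; _*_) renaming (_≤_ to _≤ℚ_)

-- A hypergraph: n vertices (Fin n), a family of m hyperedges (indexed by Fin m,
-- repetitions allowed), each a subset of the vertex set.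
record Hypergraph : Set where
  constructor hg
  field
    nV : ℕ
    nE : ℕ
    edge : Fin nE → Subset nV
open Hypergraph public

count : ∀ {m} → (Fin m → Bool) → ℕ
count {zero}  f = 0
count {suc m} f with f zero
... | true  = suc (count (λ j → f (suc j)))
... | false = count (λ j → f (suc j))

memb : ∀ {n} → Fin n → Subset n → Bool
memb i X with i ∈? X
... | yes _ = true
... | no  _ = false

degree : (G : Hypergraph) → Fin (nV G) → ℕ
degree G v = count (λ j → memb v (edge G j))

-- degree sequence (as a list; compared up to permutation = as multisets)
degreeSeq : Hypergraph → List ℕ
degreeSeq G = map (degree G) (allFin (nV G))

edgeSizes : Hypergraph → List ℕ
edgeSizes G = map (λ j → ∣ edge G j ∣) (allFin (nE G))

Matrix : ℕ → ℕ → Set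
Matrix p q = Fin p → Fin q → ℚ

Σ[<_]_ : (k : ℕ) → (Fin k → ℚ) → ℚ
Σ[< zero ] f = 0ℚ
Σ[< suc k ] f = f zero + Σ[< k ] (λ i → f (suc i))

infixl 7 _⊗_
_⊗_ : ∀ {p q r} → Matrix p q → Matrix q r → Matrix p r
_⊗_ {q = q} A B i j = Σ[< q ] (λ k → A i k * B k j)

transpose : ∀ {p q} → Matrix p q → Matrix q p
transpose A i j = A j i

b2q : Bool → ℚ
b2q true  = 1ℚ
b2q false = 0ℚ

incidence : (G : Hypergraph) → Matrix (nV G) (nE G)
incidence G i j = b2q (memb i (edge G j))

-- dual hypergraph: incidence matrix is the transpose
dual : Hypergraph → Hypergraph
dual G = hg (nE G) (nV G) (λ j → tabulate (λ i → lookup (edge G i) j))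

record DoublyStochastic {p q : ℕ} (S : Matrix p q) : Set where
  field
    square  : p ≡ q
    nonneg  : ∀ i j → 0ℚ ≤ℚ S i j
    rowSum  : ∀ i → Σ[< q ] (λ j → S i j) ≡ 1ℚ
    colSum  : ∀ j → Σ[< p ] (λ i → S i j) ≡ 1ℚ

infix 4 _≐_
_≐_ : ∀ {p q} → Matrix p q → Matrix p q → Set
A ≐ B = ∀ i j → A i j ≡ B i j

_≅f_ : Hypergraph → Hypergraph → Set
G ≅f H =
  (nV G ≡ nV H × nE G ≡ 0 × nE H ≡ 0)
  ⊎ (1 ≤ nE G × 1 ≤ nE H ×
     Σ (Matrix (nV H) (nV G)) λ S₁ → Σ (Matrix (nE G) (nE H)) λ S₂ →
       DoublyStochastic S₁ × DoublyStochastic S₂ ×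
       (S₁ ⊗ incidence G ≐ incidence H ⊗ transpose S₂) ×
       (incidence G ⊗ S₂ ≐ transpose S₁ ⊗ incidence H))

{-# OPTIONS --safe #-}
module Submission where

-- Summing the rows of S₁ M_G = M_H S₂ᵗ and of M_G S₂ = S₁ᵗ M_H gives d_H = S₁ d_G and
-- d_G = S₁ᵗ d_H for the degree vectors. By Jensen's inequality for the convex functions
-- x ↦ (x − k)⁺, a doubly stochastic matrix can only decrease the excess sums Σᵢ (dᵢ − k)⁺,
-- so d_G and d_H have the same excess sums for every k. These determine how many entries
-- are at least k, hence the multiset of degrees. Transposing both identities shows that
-- (S₂ᵗ, S₁ᵗ) witnesses G* ≅f H*, and the hyperedge sizes of G are the degrees of G*.

open import Defs
open import Algebra.Bundles using (CommutativeRing)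
import Algebra.Properties.CommutativeSemigroup as CommutativeSemigroupProperties
import Algebra.Properties.Group as GroupProperties
import Algebra.Properties.Monoid.Mult as MonoidMult
import Algebra.Properties.Semiring.Sum as SemiringSum
open import Data.Bool using (Bool; true; false; if_then_else_)
open import Data.Bool.Properties using (T-≡)
open import Data.Fin using (Fin; zero; suc)
open import Data.Fin.Subset using (Subset; ∣_∣)
open import Data.Fin.Subset.Properties using (_∈?_)
open import Data.List using (List; []; _∷_; _++_; map; tabulate; length)
open import Data.List.Membership.Propositional using (_∈_)
open import Data.List.Membership.Propositional.Properties using (∈-∃++)
import Data.List.Properties as ListP
open import Data.List.Relation.Binary.Permutation.Propositional
  using (_↭_; ↭-refl; ↭-sym; ↭-trans; prep)
open import Data.List.Relation.Binary.Permutation.Propositional.Properties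
  using (shift; map⁺)
open import Data.List.Relation.Unary.Any using (here; there)
open import Data.Nat as ℕ using (ℕ; zero; suc; z≤n; s≤s; _∸_; _≤ᵇ_; _≡ᵇ_)
open import Data.Nat.ListAction using (sum)
open import Data.Nat.ListAction.Properties using (sum-↭)
import Data.Nat.Properties as ℕP
open import Data.Product using (_×_; _,_)
open import Data.Rational using (ℚ; 0ℚ; 1ℚ; _+_; _*_; -_; _≤_; _<_; nonNegative)
import Data.Rational.Properties as ℚP
open import Data.Sum using (inj₁; inj₂)
open import Data.Vec as Vec using (lookup)
import Data.Vec.Properties as VecP
open import Function using (_∘_; id; Equivalence)
open import Relation.Binary.PropositionalEquality
  using (_≡_; _≗_; refl; sym; trans; cong; cong₂; subst; subst₂; module ≡-Reasoning)
open import Relation.Nullary using (yes; no; contradiction)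

open CommutativeRing ℚP.+-*-commutativeRing using (semiring)
module ℚΣ = SemiringSum semiring
open MonoidMult ℚP.+-0-monoid using (×-homo-+) renaming (_×_ to _×ℚ_)
open DoublyStochastic using (square; nonneg; rowSum; colSum)

+-cancelˡ-≤ : ∀ r {p q} → r + p ≤ r + q → p ≤ q
+-cancelˡ-≤ r {p} {q} =
  subst₂ _≤_ (\\-leftDividesʳ r p) (\\-leftDividesʳ r q) ∘ ℚP.+-monoʳ-≤ (- r)
  where open GroupProperties ℚP.+-0-group using (\\-leftDividesʳ)

*-monoˡ-≤-nonneg : ∀ {r p q} → 0ℚ ≤ r → p ≤ q → r * p ≤ r * q
*-monoˡ-≤-nonneg {r} 0≤r = ℚP.*-monoˡ-≤-nonNeg r {{nonNegative 0≤r}}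

*-nonneg : ∀ {p q} → 0ℚ ≤ p → 0ℚ ≤ q → 0ℚ ≤ p * q
*-nonneg {p} 0≤p 0≤q = subst (_≤ p * _) (ℚP.*-zeroʳ p) (*-monoˡ-≤-nonneg 0≤p 0≤q)

fromℕ : ℕ → ℚ
fromℕ n = n ×ℚ 1ℚ

fromℕ-+ : ∀ m n → fromℕ (m ℕ.+ n) ≡ fromℕ m + fromℕ n
fromℕ-+ = ×-homo-+ 1ℚ

fromℕ-nonneg : ∀ n → 0ℚ ≤ fromℕ n
fromℕ-nonneg zero    = ℚP.≤-refl
fromℕ-nonneg (suc n) = ℚP.+-mono-≤ (ℚP.nonNegative⁻¹ 1ℚ) (fromℕ-nonneg n)

fromℕ-mono-≤ : ∀ {m n} → m ℕ.≤ n → fromℕ m ≤ fromℕ n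
fromℕ-mono-≤ {n = n} z≤n = fromℕ-nonneg n
fromℕ-mono-≤ (s≤s m≤n)   = ℚP.+-monoʳ-≤ 1ℚ (fromℕ-mono-≤ m≤n)

fromℕ-cancel-≤ : ∀ {m n} → fromℕ m ≤ fromℕ n → m ℕ.≤ n
fromℕ-cancel-≤ {zero}          _ = z≤n
fromℕ-cancel-≤ {suc m} {zero}  h = contradiction (ℚP.<-≤-trans 0<1+m h) (ℚP.<-irrefl refl)
  where
  0<1+m : 0ℚ < fromℕ (suc m)
  0<1+m = ℚP.+-mono-<-≤ (ℚP.positive⁻¹ 1ℚ) (fromℕ-nonneg m)
fromℕ-cancel-≤ {suc m} {suc n} h = s≤s (fromℕ-cancel-≤ (+-cancelˡ-≤ 1ℚ h))

Σ≡sum : ∀ {k} (f : Fin k → ℚ) → Σ[< k ] f ≡ ℚΣ.sum f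
Σ≡sum {zero}  f = refl
Σ≡sum {suc k} f = cong (f zero +_) (Σ≡sum (f ∘ suc))

Σ-cong : ∀ {k} {f g : Fin k → ℚ} → f ≗ g → Σ[< k ] f ≡ Σ[< k ] g
Σ-cong {f = f} {g} f≗g = trans (Σ≡sum f) (trans (ℚΣ.sum-cong-≗ f≗g) (sym (Σ≡sum g)))

Σ-zero : ∀ k → Σ[< k ] (λ _ → 0ℚ) ≡ 0ℚ
Σ-zero k = trans (Σ≡sum {k} (λ _ → 0ℚ)) (ℚΣ.sum-replicate-zero k)

Σ-+ : ∀ {k} (f g : Fin k → ℚ) → Σ[< k ] (λ i → f i + g i) ≡ Σ[< k ] f + Σ[< k ] g
Σ-+ f g = begin
  Σ[< _ ] (λ i → f i + g i)  ≡⟨ Σ≡sum (λ i → f i + g i) ⟩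
  ℚΣ.sum (λ i → f i + g i)   ≡⟨ ℚΣ.∑-distrib-+ f g ⟩
  ℚΣ.sum f + ℚΣ.sum g        ≡⟨ cong₂ _+_ (Σ≡sum f) (Σ≡sum g) ⟨
  Σ[< _ ] f + Σ[< _ ] g      ∎
  where open ≡-Reasoning

Σ-*ˡ : ∀ {k} c (f : Fin k → ℚ) → Σ[< k ] (λ i → c * f i) ≡ c * Σ[< k ] f
Σ-*ˡ c f = begin
  Σ[< _ ] (λ i → c * f i)  ≡⟨ Σ≡sum (λ i → c * f i) ⟩
  ℚΣ.sum (λ i → c * f i)   ≡⟨ ℚΣ.*-distribˡ-sum c f ⟨
  c * ℚΣ.sum f             ≡⟨ cong (c *_) (Σ≡sum f) ⟨
  c * Σ[< _ ] f            ∎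
  where open ≡-Reasoning

Σ-*ʳ : ∀ {k} c (f : Fin k → ℚ) → Σ[< k ] (λ i → f i * c) ≡ Σ[< k ] f * c
Σ-*ʳ c f = begin
  Σ[< _ ] (λ i → f i * c)  ≡⟨ Σ≡sum (λ i → f i * c) ⟩
  ℚΣ.sum (λ i → f i * c)   ≡⟨ ℚΣ.*-distribʳ-sum c f ⟨
  ℚΣ.sum f * c             ≡⟨ cong (_* c) (Σ≡sum f) ⟨
  Σ[< _ ] f * c            ∎
  where open ≡-Reasoning

Σ-swap : ∀ {p q} (f : Fin p → Fin q → ℚ) →
         Σ[< p ] (λ i → Σ[< q ] (f i)) ≡ Σ[< q ] (λ j → Σ[< p ] (λ i → f i j))
Σ-swap f = trans (Σ²≡sum² f) (trans (ℚΣ.∑-comm f) (sym (Σ²≡sum² (λ j i → f i j))))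
  where
  Σ²≡sum² : ∀ {p q} (g : Fin p → Fin q → ℚ) →
            Σ[< p ] (λ i → Σ[< q ] (g i)) ≡ ℚΣ.sum (λ i → ℚΣ.sum (g i))
  Σ²≡sum² g = trans (Σ≡sum (λ i → Σ[< _ ] (g i))) (ℚΣ.sum-cong-≗ (λ i → Σ≡sum (g i)))

Σ-mono-≤ : ∀ {k} {f g : Fin k → ℚ} → (∀ i → f i ≤ g i) → Σ[< k ] f ≤ Σ[< k ] g
Σ-mono-≤ {zero}  _   = ℚP.≤-refl
Σ-mono-≤ {suc k} f≤g = ℚP.+-mono-≤ (f≤g zero) (Σ-mono-≤ (f≤g ∘ suc))

Σ-nonneg : ∀ {k} {f : Fin k → ℚ} → (∀ i → 0ℚ ≤ f i) → 0ℚ ≤ Σ[< k ] f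
Σ-nonneg {k} {f} 0≤f = subst (_≤ Σ[< k ] f) (Σ-zero k) (Σ-mono-≤ 0≤f)

fromℕ-sum-tabulate : ∀ {k} (f : Fin k → ℕ) → fromℕ (sum (tabulate f)) ≡ Σ[< k ] (fromℕ ∘ f)
fromℕ-sum-tabulate {zero}  f = refl
fromℕ-sum-tabulate {suc k} f =
  trans (fromℕ-+ (f zero) _) (cong (fromℕ (f zero) +_) (fromℕ-sum-tabulate (f ∘ suc)))

infixr 7 _▸_

_▸_ : ∀ {p q} → Matrix p q → (Fin q → ℚ) → Fin p → ℚ
(A ▸ x) i = Σ[< _ ] (λ j → A i j * x j)

rowSums : ∀ {p q} → Matrix p q → Fin p → ℚ
rowSums A i = Σ[< _ ] (A i)

▸-congʳ : ∀ {p q} (A : Matrix p q) {x y : Fin q → ℚ} → x ≗ y → A ▸ x ≗ A ▸ y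
▸-congʳ A x≗y i = Σ-cong (λ j → cong (A i j *_) (x≗y j))

⊗-congˡ : ∀ {p q r} {A A′ : Matrix p q} → A ≐ A′ → (B : Matrix q r) → A ⊗ B ≐ A′ ⊗ B
⊗-congˡ A≐A′ B i k = Σ-cong (λ j → cong (_* B j k) (A≐A′ i j))

⊗-congʳ : ∀ {p q r} (A : Matrix p q) {B B′ : Matrix q r} → B ≐ B′ → A ⊗ B ≐ A ⊗ B′
⊗-congʳ A B≐B′ i k = Σ-cong (λ j → cong (A i j *_) (B≐B′ j k))

transpose-⊗ : ∀ {p q r} (A : Matrix p q) (B : Matrix q r) →
              transpose (A ⊗ B) ≐ transpose B ⊗ transpose A
transpose-⊗ A B i k = Σ-cong (λ j → ℚP.*-comm (A k j) (B j i))

transpose-intertwining : ∀ {p p′ q q′} (A : Matrix p p′) (M : Matrix p′ q′)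
                           (N : Matrix p q) (B : Matrix q q′) → A ⊗ M ≐ N ⊗ B →
                         transpose M ⊗ transpose A ≐ transpose B ⊗ transpose N
transpose-intertwining A M N B AM≐NB i j =
  trans (sym (transpose-⊗ A M i j)) (trans (AM≐NB j i) (transpose-⊗ N B i j))

rowSums-⊗ : ∀ {p q r} (A : Matrix p q) (B : Matrix q r) → rowSums (A ⊗ B) ≗ A ▸ rowSums B
rowSums-⊗ A B i =
  trans (Σ-swap (λ k j → A i j * B j k)) (Σ-cong (λ j → Σ-*ˡ (A i j) (B j)))

rowSums-intertwined : ∀ {p p′ q q′} (A : Matrix p p′) (M : Matrix p′ q′)
                        (N : Matrix p q) (B : Matrix q q′) → A ⊗ M ≐ N ⊗ B →
                      (∀ j → rowSums B j ≡ 1ℚ) → rowSums N ≗ A ▸ rowSums M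
rowSums-intertwined A M N B AM≐NB B-rows i = begin
  rowSums N i         ≡⟨ Σ-cong (λ j → ℚP.*-identityʳ (N i j)) ⟨
  (N ▸ (λ _ → 1ℚ)) i  ≡⟨ ▸-congʳ N B-rows i ⟨
  (N ▸ rowSums B) i   ≡⟨ rowSums-⊗ N B i ⟨
  rowSums (N ⊗ B) i   ≡⟨ Σ-cong (AM≐NB i) ⟨
  rowSums (A ⊗ M) i   ≡⟨ rowSums-⊗ A M i ⟩
  (A ▸ rowSums M) i   ∎
  where open ≡-Reasoning

Σ-▸ : ∀ {p q} (A : Matrix p q) → (∀ j → Σ[< p ] (λ i → A i j) ≡ 1ℚ) →
      ∀ x → Σ[< p ] (A ▸ x) ≡ Σ[< q ] x
Σ-▸ A A-cols x = begin
  Σ[< _ ] (λ i → Σ[< _ ] (λ j → A i j * x j))  ≡⟨ Σ-swap (λ i j → A i j * x j) ⟩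
  Σ[< _ ] (λ j → Σ[< _ ] (λ i → A i j * x j))  ≡⟨ Σ-cong (λ j → Σ-*ʳ (x j) (λ i → A i j)) ⟩
  Σ[< _ ] (λ j → Σ[< _ ] (λ i → A i j) * x j)  ≡⟨ Σ-cong (λ j → cong (_* x j) (A-cols j)) ⟩
  Σ[< _ ] (λ j → 1ℚ * x j)                     ≡⟨ Σ-cong (λ j → ℚP.*-identityˡ (x j)) ⟩
  Σ[< _ ] x                                    ∎
  where open ≡-Reasoning

transpose-doublyStochastic : ∀ {p q} {S : Matrix p q} →
                             DoublyStochastic S → DoublyStochastic (transpose S)
transpose-doublyStochastic S-ds = record
  { square = sym (square S-ds)
  ; nonneg = λ i j → nonneg S-ds j i
  ; rowSum = colSum S-ds
  ; colSum = rowSum S-ds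
  }

identity : ∀ {n} → Matrix n n
identity zero    zero    = 1ℚ
identity zero    (suc _) = 0ℚ
identity (suc _) zero    = 0ℚ
identity (suc i) (suc j) = identity i j

identity-doublyStochastic : ∀ {n} → DoublyStochastic (identity {n})
identity-doublyStochastic = record
  { square = refl
  ; nonneg = identity-nonneg
  ; rowSum = identity-rowSum
  ; colSum = identity-colSum
  }
  where
  identity-nonneg : ∀ {n} (i j : Fin n) → 0ℚ ≤ identity i j
  identity-nonneg zero    zero    = ℚP.nonNegative⁻¹ 1ℚ
  identity-nonneg zero    (suc j) = ℚP.≤-refl
  identity-nonneg (suc i) zero    = ℚP.≤-refl
  identity-nonneg (suc i) (suc j) = identity-nonneg i j

  identity-rowSum : ∀ {n} (i : Fin n) → Σ[< n ] (identity i) ≡ 1ℚ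
  identity-rowSum {suc n} zero    = trans (cong (1ℚ +_) (Σ-zero n)) (ℚP.+-identityʳ 1ℚ)
  identity-rowSum {suc n} (suc i) = trans (ℚP.+-identityˡ _) (identity-rowSum i)

  identity-colSum : ∀ {n} (j : Fin n) → Σ[< n ] (λ i → identity i j) ≡ 1ℚ
  identity-colSum {suc n} zero    = trans (cong (1ℚ +_) (Σ-zero n)) (ℚP.+-identityʳ 1ℚ)
  identity-colSum {suc n} (suc j) = trans (ℚP.+-identityˡ _) (identity-colSum j)

-- Multisets of natural numbers

indicator : Bool → ℕ
indicator b = if b then 1 else 0

excess : ℕ → List ℕ → ℕ
excess k xs = sum (map (_∸ k) xs)

atLeast : ℕ → List ℕ → ℕ
atLeast k xs = sum (map (λ x → indicator (k ≤ᵇ x)) xs)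

multiplicity : ℕ → List ℕ → ℕ
multiplicity k xs = sum (map (λ x → indicator (k ≡ᵇ x)) xs)

sum-map-+ : ∀ {f g h : ℕ → ℕ} → (∀ x → f x ≡ g x ℕ.+ h x) →
            ∀ xs → sum (map f xs) ≡ sum (map g xs) ℕ.+ sum (map h xs)
sum-map-+ f≡g+h []       = refl
sum-map-+ {f} {g} {h} f≡g+h (x ∷ xs) = begin
  f x ℕ.+ sum (map f xs)
    ≡⟨ cong₂ ℕ._+_ (f≡g+h x) (sum-map-+ f≡g+h xs) ⟩
  (g x ℕ.+ h x) ℕ.+ (sum (map g xs) ℕ.+ sum (map h xs))
    ≡⟨ interchange (g x) (h x) _ _ ⟩
  (g x ℕ.+ sum (map g xs)) ℕ.+ (h x ℕ.+ sum (map h xs))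
    ∎
  where
  open ≡-Reasoning
  open CommutativeSemigroupProperties ℕP.+-commutativeSemigroup using (interchange)

left-summands-≡ : ∀ {a a′ b b′ c c′} → a ≡ b ℕ.+ c → a′ ≡ b′ ℕ.+ c′ → a ≡ a′ → c ≡ c′ → b ≡ b′
left-summands-≡ {b = b} {b′} {c} a≡b+c a′≡b′+c′ refl refl =
  ℕP.+-cancelʳ-≡ c b b′ (trans (sym a≡b+c) a′≡b′+c′)

∸-split : ∀ x k → x ∸ k ≡ indicator (suc k ≤ᵇ x) ℕ.+ (x ∸ suc k)
∸-split zero    zero    = refl
∸-split zero    (suc k) = refl
∸-split (suc x) zero    = refl
∸-split (suc x) (suc k) = ∸-split x k

≤ᵇ-split : ∀ x k → indicator (k ≤ᵇ x) ≡ indicator (k ≡ᵇ x) ℕ.+ indicator (suc k ≤ᵇ x)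
≤ᵇ-split zero    zero          = refl
≤ᵇ-split zero    (suc k)       = refl
≤ᵇ-split (suc x) zero          = refl
≤ᵇ-split (suc x) (suc zero)    = ≤ᵇ-split x zero
≤ᵇ-split (suc x) (suc (suc k)) = ≤ᵇ-split x (suc k)

excess-suc : ∀ k xs → excess k xs ≡ atLeast (suc k) xs ℕ.+ excess (suc k) xs
excess-suc k = sum-map-+ (λ x → ∸-split x k)

atLeast-suc : ∀ k xs → atLeast k xs ≡ multiplicity k xs ℕ.+ atLeast (suc k) xs
atLeast-suc k = sum-map-+ (λ x → ≤ᵇ-split x k)

atLeast-zero : ∀ xs → atLeast 0 xs ≡ length xs
atLeast-zero []       = refl
atLeast-zero (x ∷ xs) = cong suc (atLeast-zero xs)

multiplicity-self : ∀ x xs → multiplicity x (x ∷ xs) ≡ suc (multiplicity x xs)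
multiplicity-self x xs =
  cong (λ b → indicator b ℕ.+ multiplicity x xs) (Equivalence.to T-≡ (ℕP.≡⇒≡ᵇ x x refl))

multiplicity-pos⇒∈ : ∀ {k} xs → 0 ℕ.< multiplicity k xs → k ∈ xs
multiplicity-pos⇒∈ {k} (x ∷ xs) pos with k ≡ᵇ x in k≡ᵇx
... | true  = here (ℕP.≡ᵇ⇒≡ k x (Equivalence.from T-≡ k≡ᵇx))
... | false = there (multiplicity-pos⇒∈ xs pos)

multiplicity-↭ : ∀ k {xs ys} → xs ↭ ys → multiplicity k xs ≡ multiplicity k ys
multiplicity-↭ k xs↭ys = sum-↭ (map⁺ (λ x → indicator (k ≡ᵇ x)) xs↭ys)

↭-from-multiplicity : ∀ xs ys → (∀ k → multiplicity k xs ≡ multiplicity k ys) → xs ↭ ys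
↭-from-multiplicity []       []       _   = ↭-refl
↭-from-multiplicity []       (y ∷ ys) m≡m =
  contradiction (trans (m≡m y) (multiplicity-self y ys)) ℕP.0≢1+n
↭-from-multiplicity (x ∷ xs) ys       m≡m
  with ∈-∃++ (multiplicity-pos⇒∈ {x} ys
                (subst (0 ℕ.<_) (trans (sym (multiplicity-self x xs)) (m≡m x)) ℕP.0<1+n))
... | as , bs , refl =
  ↭-trans (prep x (↭-from-multiplicity xs (as ++ bs) m≡m′)) (↭-sym (shift x as bs))
  where
  m≡m′ : ∀ k → multiplicity k xs ≡ multiplicity k (as ++ bs)
  m≡m′ k = ℕP.+-cancelˡ-≡ (indicator (k ≡ᵇ x)) _ _
             (trans (m≡m k) (multiplicity-↭ k (shift x as bs)))

↭-from-excess : ∀ {xs ys} → length xs ≡ length ys →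
                (∀ k → excess k xs ≡ excess k ys) → xs ↭ ys
↭-from-excess {xs} {ys} len e≡e = ↭-from-multiplicity xs ys m≡m
  where
  a≡a : ∀ k → atLeast k xs ≡ atLeast k ys
  a≡a zero    = trans (atLeast-zero xs) (trans len (sym (atLeast-zero ys)))
  a≡a (suc k) = left-summands-≡ (excess-suc k xs) (excess-suc k ys) (e≡e k) (e≡e (suc k))

  m≡m : ∀ k → multiplicity k xs ≡ multiplicity k ys
  m≡m k = left-summands-≡ (atLeast-suc k xs) (atLeast-suc k ys) (a≡a k) (a≡a (suc k))

-- Majorization by doubly stochastic matrices

excess-convex : ∀ {n} (w : Fin n → ℚ) → (∀ j → 0ℚ ≤ w j) → Σ[< n ] w ≡ 1ℚ →
                (u : Fin n → ℕ) {c : ℕ} → fromℕ c ≡ Σ[< n ] (λ j → w j * fromℕ (u j)) →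
                ∀ k → fromℕ (c ∸ k) ≤ Σ[< n ] (λ j → w j * fromℕ (u j ∸ k))
excess-convex w 0≤w Σw≡1 u {c} c≡wu k with ℕP.≤-total k c
... | inj₂ c≤k rewrite ℕP.m≤n⇒m∸n≡0 c≤k =
  Σ-nonneg (λ j → *-nonneg (0≤w j) (fromℕ-nonneg (u j ∸ k)))
... | inj₁ k≤c = +-cancelˡ-≤ (fromℕ k) (begin
  fromℕ k + fromℕ (c ∸ k)
    ≡⟨ fromℕ-+ k (c ∸ k) ⟨
  fromℕ (k ℕ.+ (c ∸ k))
    ≡⟨ cong fromℕ (ℕP.m+[n∸m]≡n k≤c) ⟩
  fromℕ c
    ≡⟨ c≡wu ⟩
  Σ[< _ ] (λ j → w j * fromℕ (u j))
    ≤⟨ Σ-mono-≤ (λ j → *-monoˡ-≤-nonneg (0≤w j) (fromℕ-mono-≤ (ℕP.m≤n+m∸n (u j) k))) ⟩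
  Σ[< _ ] (λ j → w j * fromℕ (k ℕ.+ (u j ∸ k)))
    ≡⟨ Σ-cong (λ j → trans (cong (w j *_) (fromℕ-+ k _)) (ℚP.*-distribˡ-+ (w j) _ _)) ⟩
  Σ[< _ ] (λ j → w j * fromℕ k + w j * fromℕ (u j ∸ k))
    ≡⟨ Σ-+ (λ j → w j * fromℕ k) (λ j → w j * fromℕ (u j ∸ k)) ⟩
  Σ[< _ ] (λ j → w j * fromℕ k) + Σ[< _ ] (λ j → w j * fromℕ (u j ∸ k))
    ≡⟨ cong (_+ Σ[< _ ] (λ j → w j * fromℕ (u j ∸ k))) Σwk≡k ⟩
  fromℕ k + Σ[< _ ] (λ j → w j * fromℕ (u j ∸ k))
    ∎)
  where
  open ℚP.≤-Reasoning
  Σwk≡k : Σ[< _ ] (λ j → w j * fromℕ k) ≡ fromℕ k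
  Σwk≡k = trans (Σ-*ʳ (fromℕ k) w) (trans (cong (_* fromℕ k) Σw≡1) (ℚP.*-identityˡ (fromℕ k)))

excess-sum-≤ : ∀ {n} {T : Matrix n n} → DoublyStochastic T → (u v : Fin n → ℕ) →
               (∀ i → fromℕ (v i) ≡ (T ▸ fromℕ ∘ u) i) →
               ∀ k → Σ[< n ] (λ i → fromℕ (v i ∸ k)) ≤ Σ[< n ] (λ j → fromℕ (u j ∸ k))
excess-sum-≤ {T = T} T-ds u v v≡Tu k = begin
  Σ[< _ ] (λ i → fromℕ (v i ∸ k))
    ≤⟨ Σ-mono-≤ (λ i → excess-convex (T i) (nonneg T-ds i) (rowSum T-ds i) u (v≡Tu i) k) ⟩
  Σ[< _ ] (T ▸ λ j → fromℕ (u j ∸ k))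
    ≡⟨ Σ-▸ T (colSum T-ds) (λ j → fromℕ (u j ∸ k)) ⟩
  Σ[< _ ] (λ j → fromℕ (u j ∸ k))
    ∎
  where open ℚP.≤-Reasoning

doublyStochastic-↭ : ∀ {n} {T : Matrix n n} → DoublyStochastic T → (u v : Fin n → ℕ) →
                     (∀ i → fromℕ (v i) ≡ (T ▸ fromℕ ∘ u) i) →
                     (∀ j → fromℕ (u j) ≡ (transpose T ▸ fromℕ ∘ v) j) →
                     tabulate u ↭ tabulate v
doublyStochastic-↭ T-ds u v v≡Tu u≡Tᵀv =
  ↭-from-excess (trans (ListP.length-tabulate u) (sym (ListP.length-tabulate v))) λ k →
    ℕP.≤-antisym
      (excess-≤ u v k (excess-sum-≤ (transpose-doublyStochastic T-ds) v u u≡Tᵀv k))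
      (excess-≤ v u k (excess-sum-≤ T-ds u v v≡Tu k))
  where
  fromℕ-excess : ∀ w k → fromℕ (excess k (tabulate w)) ≡ Σ[< _ ] (λ i → fromℕ (w i ∸ k))
  fromℕ-excess w k =
    trans (cong (fromℕ ∘ sum) (ListP.map-tabulate w (_∸ k))) (fromℕ-sum-tabulate (λ i → w i ∸ k))

  excess-≤ : ∀ w w′ k →
             Σ[< _ ] (λ i → fromℕ (w i ∸ k)) ≤ Σ[< _ ] (λ i → fromℕ (w′ i ∸ k)) →
             excess k (tabulate w) ℕ.≤ excess k (tabulate w′)
  excess-≤ w w′ k = fromℕ-cancel-≤ ∘ subst₂ _≤_ (sym (fromℕ-excess w k)) (sym (fromℕ-excess w′ k))

memb-lookup : ∀ {n} (i : Fin n) (X : Subset n) → memb i X ≡ lookup X i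
memb-lookup i X with i ∈? X
... | yes i∈X = sym (VecP.[]=⇒lookup i∈X)
... | no i∉X with lookup X i in eq
...   | false = refl
...   | true  = contradiction (VecP.lookup⇒[]= i X eq) i∉X

count-cong : ∀ {m} {f g : Fin m → Bool} → f ≗ g → count f ≡ count g
count-cong {zero}          _   = refl
count-cong {suc m} {f} {g} f≗g with f zero | g zero | f≗g zero
... | true  | true  | refl = cong suc (count-cong (f≗g ∘ suc))
... | false | false | refl = count-cong (f≗g ∘ suc)

count-lookup : ∀ {n} (X : Subset n) → count (lookup X) ≡ ∣ X ∣
count-lookup Vec.[]           = refl
count-lookup (true  Vec.∷ X) = cong suc (count-lookup X)
count-lookup (false Vec.∷ X) = count-lookup X

fromℕ-count : ∀ {m} (f : Fin m → Bool) → fromℕ (count f) ≡ Σ[< m ] (b2q ∘ f)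
fromℕ-count {zero}  f = refl
fromℕ-count {suc m} f with f zero
... | true  = cong (1ℚ +_) (fromℕ-count (f ∘ suc))
... | false = trans (fromℕ-count (f ∘ suc)) (sym (ℚP.+-identityˡ _))

rowSums-incidence : ∀ G → rowSums (incidence G) ≗ fromℕ ∘ degree G
rowSums-incidence G i = sym (fromℕ-count (λ j → memb i (edge G j)))

memb-dual : ∀ G a i → memb a (edge (dual G) i) ≡ memb i (edge G a)
memb-dual G a i = begin
  memb a (edge (dual G) i)        ≡⟨ memb-lookup a (edge (dual G) i) ⟩
  lookup (edge (dual G) i) a      ≡⟨ VecP.lookup∘tabulate (λ a′ → lookup (edge G a′) i) a ⟩
  lookup (edge G a) i             ≡⟨ memb-lookup i (edge G a) ⟨
  memb i (edge G a)               ∎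
  where open ≡-Reasoning

incidence-dual : ∀ G → incidence (dual G) ≐ transpose (incidence G)
incidence-dual G a i = cong b2q (memb-dual G a i)

degree-dual : ∀ G a → degree (dual G) a ≡ ∣ edge G a ∣
degree-dual G a = trans (count-cong (λ i → trans (memb-dual G a i) (memb-lookup i (edge G a))))
                        (count-lookup (edge G a))

edgeSizes≡degreeSeq-dual : ∀ G → edgeSizes G ≡ degreeSeq (dual G)
edgeSizes≡degreeSeq-dual G = sym (ListP.map-cong (degree-dual G) _)

degreeSeq≡tabulate : ∀ G → degreeSeq G ≡ tabulate (degree G)
degreeSeq≡tabulate G = ListP.map-tabulate id (degree G)

degrees-intertwined : ∀ {G H} (A : Matrix (nV H) (nV G)) (B : Matrix (nE H) (nE G)) →
                      A ⊗ incidence G ≐ incidence H ⊗ B → (∀ j → rowSums B j ≡ 1ℚ) →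
                      ∀ i → fromℕ (degree H i) ≡ (A ▸ fromℕ ∘ degree G) i
degrees-intertwined {G} {H} A B AM≐NB B-rows i = begin
  fromℕ (degree H i)
    ≡⟨ rowSums-incidence H i ⟨
  rowSums (incidence H) i
    ≡⟨ rowSums-intertwined A (incidence G) (incidence H) B AM≐NB B-rows i ⟩
  (A ▸ rowSums (incidence G)) i
    ≡⟨ ▸-congʳ A (rowSums-incidence G) i ⟩
  (A ▸ fromℕ ∘ degree G) i
    ∎
  where open ≡-Reasoning

≅f-intro : ∀ {G H} (S₁ : Matrix (nV H) (nV G)) (S₂ : Matrix (nE G) (nE H)) →
           DoublyStochastic S₁ → DoublyStochastic S₂ →
           S₁ ⊗ incidence G ≐ incidence H ⊗ transpose S₂ →
           incidence G ⊗ S₂ ≐ transpose S₁ ⊗ incidence H → G ≅f H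
≅f-intro {hg n zero e}    S₁ S₂ S₁-ds S₂-ds _  _  =
  inj₁ (sym (square S₁-ds) , refl , sym (square S₂-ds))
≅f-intro {hg n (suc m) e} S₁ S₂ S₁-ds S₂-ds E₁ E₂ =
  inj₂ (s≤s z≤n , subst (1 ℕ.≤_) (square S₂-ds) (s≤s z≤n) , S₁ , S₂ , S₁-ds , S₂-ds , E₁ , E₂)

≅f⇒nV≡ : ∀ {G H} → G ≅f H → nV G ≡ nV H
≅f⇒nV≡ (inj₁ (nV≡ , _))                   = nV≡
≅f⇒nV≡ (inj₂ (_ , _ , _ , _ , S₁-ds , _)) = sym (square S₁-ds)

≅f⇒nE≡ : ∀ {G H} → G ≅f H → nE G ≡ nE H
≅f⇒nE≡ (inj₁ (_ , nE-G≡0 , nE-H≡0))           = trans nE-G≡0 (sym nE-H≡0)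
≅f⇒nE≡ (inj₂ (_ , _ , _ , _ , _ , S₂-ds , _)) = square S₂-ds

≅f⇒degreeSeq-↭ : ∀ {G H} → G ≅f H → degreeSeq G ↭ degreeSeq H
≅f⇒degreeSeq-↭ {hg n _ _} {hg .n _ _} (inj₁ (refl , refl , refl)) = ↭-refl
≅f⇒degreeSeq-↭ {G@(hg _ _ _)} {H@(hg _ _ _)} (inj₂ (_ , _ , S₁ , S₂ , S₁-ds , S₂-ds , E₁ , E₂))
  with refl ← square S₁-ds =
  subst₂ _↭_ (sym (degreeSeq≡tabulate G)) (sym (degreeSeq≡tabulate H))
    (doublyStochastic-↭ S₁-ds (degree G) (degree H)
      (degrees-intertwined S₁ (transpose S₂) E₁ (colSum S₂-ds))
      (degrees-intertwined (transpose S₁) S₂ (λ i j → sym (E₂ i j)) (rowSum S₂-ds)))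

≅f⇒dual-≅f : ∀ {G H} → G ≅f H → dual G ≅f dual H
-- In the edgeless case both duals have no vertices, so the intertwining equations are vacuous.
≅f⇒dual-≅f {hg n _ _} {hg .n _ _} (inj₁ (refl , refl , refl)) =
  ≅f-intro identity identity identity-doublyStochastic identity-doublyStochastic (λ ()) (λ ())
≅f⇒dual-≅f {G} {H} (inj₂ (_ , _ , S₁ , S₂ , S₁-ds , S₂-ds , E₁ , E₂)) =
  ≅f-intro (transpose S₂) (transpose S₁)
    (transpose-doublyStochastic S₂-ds) (transpose-doublyStochastic S₁-ds) E₁* E₂*
  where
  open ≡-Reasoning
  E₁* : transpose S₂ ⊗ incidence (dual G) ≐ incidence (dual H) ⊗ S₁
  E₁* i j = begin
    (transpose S₂ ⊗ incidence (dual G)) i j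
      ≡⟨ ⊗-congʳ (transpose S₂) (incidence-dual G) i j ⟩
    (transpose S₂ ⊗ transpose (incidence G)) i j
      ≡⟨ transpose-intertwining (incidence G) S₂ (transpose S₁) (incidence H) E₂ i j ⟩
    (transpose (incidence H) ⊗ S₁) i j
      ≡⟨ ⊗-congˡ (incidence-dual H) S₁ i j ⟨
    (incidence (dual H) ⊗ S₁) i j
      ∎

  E₂* : incidence (dual G) ⊗ transpose S₁ ≐ S₂ ⊗ incidence (dual H)
  E₂* i j = begin
    (incidence (dual G) ⊗ transpose S₁) i j
      ≡⟨ ⊗-congˡ (incidence-dual G) (transpose S₁) i j ⟩
    (transpose (incidence G) ⊗ transpose S₁) i j
      ≡⟨ transpose-intertwining S₁ (incidence G) (incidence H) (transpose S₂) E₁ i j ⟩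
    (S₂ ⊗ transpose (incidence H)) i j
      ≡⟨ ⊗-congʳ S₂ (incidence-dual H) i j ⟨
    (S₂ ⊗ incidence (dual H)) i j
      ∎

mainTheorem7 : (G H : Hypergraph) → G ≅f H →
    (nV G ≡ nV H) × (nE G ≡ nE H) × (degreeSeq G ↭ degreeSeq H) ×
    (edgeSizes G ↭ edgeSizes H) × (dual G ≅f dual H)
mainTheorem7 G H G≅H = ≅f⇒nV≡ G≅H , ≅f⇒nE≡ G≅H , ≅f⇒degreeSeq-↭ G≅H , edgeSizes-↭ , G*≅H*
  where
  G*≅H* : dual G ≅f dual H
  G*≅H* = ≅f⇒dual-≅f G≅H

  edgeSizes-↭ : edgeSizes G ↭ edgeSizes H
  edgeSizes-↭ = subst₂ _↭_ (sym (edgeSizes≡degreeSeq-dual G)) (sym (edgeSizes≡degreeSeq-dual H))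
                           (≅f⇒degreeSeq-↭ G*≅H*)
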